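{- A P-encoding with $n$ input variables is an encoding (not necessarily propagation complete) of either $\mathrm{AMO}_n$ or $\mathrm{EO}_n$.
   Context: A CNF formula is a conjunction of clauses (disjunctions of literals with no complementary pair). Unit resolution: from a unit clause $l$ and a clause containing $\neg l$ derive the clause with $\neg l$ removed; $\varphi\wedge g\vdash_1 h$ means the literal $h$ is derivable from $\varphi$ and the unit clause $g$ by a sequence of unit resolutions. $\mathrm{AMO}_n(x_1,\dots,x_n)=1$ iff at most one $x_i$ is $1$; $\mathrm{EO}_n(x_1,\dots,x_n)=1$ iff exactly one $x_i$ is $1$. A CNF $\varphi(\mathbf{x},\mathbf{y})$ with input variables $\mathbf{x}=(x_1,\dots,x_n)$ and auxiliary variables $\mathbf{y}=(y_1,\dots,y_\ell)$ is an encoding of $f(\mathbf{x})$ if for all $\alpha\in\{0,1\}^n$: $f(\alpha)=1$ iff $\exists\beta\in\{0,1\}^\ell$, $\varphi(\alpha,\beta)=1$. $\varphi(\mathbf{x},\mathbf{y})$ is a P-encoding if (P1) $\varphi\wedge x_i$ is satisfiable for each $i$ and (P2) $\varphi\wedge x_i\vdash_1\neg x_j$ for all $i\ne j$. -}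

module Defs where

open import Data.Nat using (ℕ; zero; suc; _+_; _≤ᵇ_; _≡ᵇ_)
open import Data.Fin using (Fin; zero; suc)
open import Data.Bool using (Bool; true; false; not; if_then_else_)
open import Data.Sum using (_⊎_; inj₁; inj₂; [_,_])
open import Data.Product using (Σ; _×_; _,_; ∃)
open import Data.List using (List; []; _∷_)
open import Data.List.Membership.Propositional using (_∈_)
open import Data.List.Relation.Unary.Any using (Any)
open import Data.List.Relation.Unary.All using (All)
open import Relation.Binary.PropositionalEquality using (_≡_; _≢_)
open import Relation.Nullary using (¬_)
open import Function.Bundles using (_⇔_)

-- Variables of a CNF φ(x, y): n input variables x and ℓ auxiliary variables y.
Var : ℕ → ℕ → Set
Var n ℓ = Fin n ⊎ Fin ℓ

data Lit (V : Set) : Set where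
  pos : V → Lit V
  neg : V → Lit V

compl : {V : Set} → Lit V → Lit V
compl (pos v) = neg v
compl (neg v) = pos v

Clause : Set → Set
Clause V = List (Lit V)

CNF : Set → Set
CNF V = List (Clause V)

NoComplementary : {V : Set} → Clause V → Set
NoComplementary {V} C = (v : V) → ¬ (pos v ∈ C × neg v ∈ C)

WellFormed : {V : Set} → CNF V → Set
WellFormed φ = All NoComplementary φ

litVal : {V : Set} → (V → Bool) → Lit V → Bool
litVal ρ (pos v) = ρ v
litVal ρ (neg v) = not (ρ v)

SatClause : {V : Set} → (V → Bool) → Clause V → Set
SatClause ρ C = Any (λ l → litVal ρ l ≡ true) C

Sat : {V : Set} → (V → Bool) → CNF V → Set
Sat ρ φ = All (SatClause ρ) φ

Satisfiable : {V : Set} → CNF V → Set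
Satisfiable {V} φ = Σ (V → Bool) λ ρ → Sat ρ φ

data Remove {V : Set} (x : Lit V) : Clause V → Clause V → Set where
  rem-[]   : Remove x [] []
  rem-hit  : ∀ {C C'} → Remove x C C' → Remove x (x ∷ C) C'
  rem-keep : ∀ {y C C'} → y ≢ x → Remove x C C' → Remove x (y ∷ C) (y ∷ C')

data UnitDerivable {V : Set} (ψ : CNF V) : Clause V → Set where
  axiom   : ∀ {C} → C ∈ ψ → UnitDerivable ψ C
  resolve : ∀ {l C C'} → UnitDerivable ψ (l ∷ []) → UnitDerivable ψ C →
            compl l ∈ C → Remove (compl l) C C' → UnitDerivable ψ C'

_∧_⊢₁_ : {V : Set} → CNF V → Lit V → Lit V → Set
φ ∧ g ⊢₁ h = UnitDerivable ((g ∷ []) ∷ φ) (h ∷ [])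

x : ∀ {n ℓ} → Fin n → Lit (Var n ℓ)
x i = pos (inj₁ i)

¬x : ∀ {n ℓ} → Fin n → Lit (Var n ℓ)
¬x i = neg (inj₁ i)

IsEncoding : ∀ {n ℓ} → CNF (Var n ℓ) → ((Fin n → Bool) → Bool) → Set
IsEncoding {n} {ℓ} φ f =
  (α : Fin n → Bool) → (f α ≡ true) ⇔ (Σ (Fin ℓ → Bool) λ β → Sat [ α , β ] φ)

-- P-encoding: (P1) φ ∧ xᵢ satisfiable for all i;
-- (P2) φ ∧ xᵢ ⊢₁ ¬xⱼ for all i ≠ j.
IsPEncoding : ∀ {n ℓ} → CNF (Var n ℓ) → Set
IsPEncoding {n} {ℓ} φ =
  ((i : Fin n) → Satisfiable ((x i ∷ []) ∷ φ)) ×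
  ((i j : Fin n) → i ≢ j → φ ∧ x i ⊢₁ ¬x j)

countTrue : ∀ {n} → (Fin n → Bool) → ℕ
countTrue {zero} α = 0
countTrue {suc n} α = (if α zero then 1 else 0) + countTrue (λ i → α (suc i))

AMO : ∀ {n} → (Fin n → Bool) → Bool
AMO α = countTrue α ≤ᵇ 1

EO : ∀ {n} → (Fin n → Bool) → Bool
EO α = countTrue α ≡ᵇ 1

module Submission where

-- Unit resolution is sound, so by (P2) every model of φ that sets some xᵢ
-- to 1 sets every other xⱼ to 0: the input part of any model has at most
-- one 1.  Conversely, by (P1) there is a model with xᵢ = 1; its input part
-- is then exactly the i-th unit vector, so every input with exactly one 1
-- extends to a model.  The only input whose status is not yet fixed is the
-- all-zero one, and whether it extends is decidable (search over the
-- finitely many auxiliary assignments).  If it extends, φ encodes AMOₙ;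
-- otherwise φ encodes EOₙ.

open import Defs
open import Data.Nat using (ℕ; zero; suc; _≤ᵇ_; _≡ᵇ_)
open import Data.Nat.Properties using (suc-injective)
open import Data.Fin using (Fin; zero; suc; _≟_)
open import Data.Fin.Properties using () renaming (suc-injective to fin-suc-injective)
open import Data.Fin.Subset.Properties using (anySubset?)
open import Data.Vec using (lookup; tabulate)
open import Data.Vec.Properties using (lookup∘tabulate)
open import Data.Bool using (Bool; true; false; not)
open import Data.Bool.Properties using (not-injective; not-involutive) renaming (_≟_ to _≟ᵇ_)
open import Data.Sum using (_⊎_; inj₁; inj₂; [_,_])
open import Data.Product using (Σ; _×_; _,_; proj₁; proj₂)
open import Data.List.Relation.Unary.Any using (Any; here; there; any?)
open import Data.List.Relation.Unary.All using (_∷_; all?)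
import Data.List.Relation.Unary.All as All
import Data.List.Relation.Unary.Any as Any
open import Data.Empty using (⊥-elim)
open import Function using (_∘_)
open import Function.Bundles using (_⇔_; mk⇔; Equivalence)
open import Relation.Nullary using (¬_; Dec; yes; no)
open import Relation.Nullary.Decidable using (map′)
open import Relation.Binary.PropositionalEquality
  using (_≡_; _≢_; _≗_; refl; sym; trans; cong)

sat-resp : ∀ {V} {ρ ρ' : V → Bool} → ρ ≗ ρ' → (φ : CNF V) → Sat ρ φ → Sat ρ' φ
sat-resp {ρ = ρ} {ρ'} ρ≗ρ' φ = All.map (Any.map λ {l} → trans (sym (litVal-resp l)))
  where
  litVal-resp : (l : Lit _) → litVal ρ l ≡ litVal ρ' l
  litVal-resp (pos v) = ρ≗ρ' v
  litVal-resp (neg v) = cong not (ρ≗ρ' v)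

sat? : ∀ {V} (ρ : V → Bool) (φ : CNF V) → Dec (Sat ρ φ)
sat? ρ = all? (any? (λ l → litVal ρ l ≟ᵇ true))

litVal-compl : ∀ {V} (ρ : V → Bool) (l : Lit V) → litVal ρ (compl l) ≡ not (litVal ρ l)
litVal-compl ρ (pos v) = refl
litVal-compl ρ (neg v) = sym (not-involutive (ρ v))

any-remove : ∀ {V} {P : Lit V → Set} {y : Lit V} {C C'} →
             Remove y C C' → ¬ P y → Any P C → Any P C'
any-remove (rem-hit r)    ¬Py (here Py) = ⊥-elim (¬Py Py)
any-remove (rem-hit r)    ¬Py (there a) = any-remove r ¬Py a
any-remove (rem-keep _ r) ¬Py (here Py) = here Py
any-remove (rem-keep _ r) ¬Py (there a) = there (any-remove r ¬Py a)

unit-sound : ∀ {V} {ρ : V → Bool} {ψ : CNF V} {C} →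
             Sat ρ ψ → UnitDerivable ψ C → SatClause ρ C
unit-sound ρ⊨ψ (axiom C∈ψ) = All.lookup ρ⊨ψ C∈ψ
unit-sound {ρ = ρ} ρ⊨ψ (resolve {l = l} unit clause _ r) with unit-sound ρ⊨ψ unit
... | here l-true = any-remove r compl-false (unit-sound ρ⊨ψ clause)
  where
  compl-false : ¬ litVal ρ (compl l) ≡ true
  compl-false p = not-true l-true (trans (sym (litVal-compl ρ l)) p)
    where
    not-true : ∀ {b} → b ≡ true → ¬ not b ≡ true
    not-true refl ()

⊢₁-sound : ∀ {V} {ρ : V → Bool} {φ : CNF V} {g h} →
           Sat ρ φ → litVal ρ g ≡ true → φ ∧ g ⊢₁ h → litVal ρ h ≡ true
⊢₁-sound ρ⊨φ g-true d with unit-sound (here g-true ∷ ρ⊨φ) d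
... | here h-true = h-true

AtMostOne : ∀ {n} → (Fin n → Bool) → Set
AtMostOne α = ∀ i j → i ≢ j → α i ≡ true → α j ≡ false

allFalse : ∀ {n} → Fin n → Bool
allFalse _ = false

count≡0⇔allFalse : ∀ {n} (α : Fin n → Bool) → countTrue α ≡ 0 ⇔ α ≗ allFalse
count≡0⇔allFalse α = mk⇔ (to α) (from α)
  where
  to : ∀ {n} (α : Fin n → Bool) → countTrue α ≡ 0 → α ≗ allFalse
  to {suc n} α e i with α zero in eq
  to {suc n} α () i      | true
  to {suc n} α e zero    | false = eq
  to {suc n} α e (suc i) | false = to (α ∘ suc) e i
  from : ∀ {n} (α : Fin n → Bool) → α ≗ allFalse → countTrue α ≡ 0
  from {zero}  α h = refl
  from {suc n} α h rewrite h zero = from (α ∘ suc) (h ∘ suc)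

count≡1⇒unit : ∀ {n} (α : Fin n → Bool) → countTrue α ≡ 1 →
               Σ (Fin n) λ i → α i ≡ true × (∀ j → j ≢ i → α j ≡ false)
count≡1⇒unit {suc n} α e with α zero in eq
... | true  = zero , eq , λ
  { zero    0≢0 → ⊥-elim (0≢0 refl)
  ; (suc j) _   → Equivalence.to (count≡0⇔allFalse (α ∘ suc)) (suc-injective e) j }
... | false with count≡1⇒unit (α ∘ suc) e
... | i , αi , others = suc i , αi , λ
  { zero    _  → eq
  ; (suc j) ne → others j (ne ∘ cong suc) }

atMostOne⇒count≤1 : ∀ {n} (α : Fin n → Bool) → AtMostOne α →
                    countTrue α ≡ 0 ⊎ countTrue α ≡ 1
atMostOne⇒count≤1 {zero}  α amo = inj₁ refl
atMostOne⇒count≤1 {suc n} α amo with α zero in eq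
... | true  = inj₂ (cong suc (Equivalence.from (count≡0⇔allFalse (α ∘ suc))
                                 (λ j → amo zero (suc j) (λ ()) eq)))
... | false = atMostOne⇒count≤1 (α ∘ suc)
                λ i j i≢j → amo (suc i) (suc j) (i≢j ∘ fin-suc-injective)

≤ᵇ1⇔ : ∀ c → (c ≤ᵇ 1) ≡ true ⇔ (c ≡ 0 ⊎ c ≡ 1)
≤ᵇ1⇔ c = mk⇔ (to c) from
  where
  to : ∀ c → (c ≤ᵇ 1) ≡ true → c ≡ 0 ⊎ c ≡ 1
  to zero          _ = inj₁ refl
  to (suc zero)    _ = inj₂ refl
  to (suc (suc c)) ()
  from : ∀ {c} → c ≡ 0 ⊎ c ≡ 1 → (c ≤ᵇ 1) ≡ true
  from (inj₁ refl) = refl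
  from (inj₂ refl) = refl

≡ᵇ1⇔ : ∀ c → (c ≡ᵇ 1) ≡ true ⇔ c ≡ 1
≡ᵇ1⇔ c = mk⇔ (to c) λ { refl → refl }
  where
  to : ∀ c → (c ≡ᵇ 1) ≡ true → c ≡ 1
  to (suc zero)    _ = refl
  to zero          ()
  to (suc (suc c)) ()

Extends : ∀ {n ℓ} → CNF (Var n ℓ) → (Fin n → Bool) → Set
Extends {ℓ = ℓ} φ α = Σ (Fin ℓ → Bool) λ β → Sat [ α , β ] φ

extends-resp : ∀ {n ℓ} (φ : CNF (Var n ℓ)) {α α'} → α ≗ α' → Extends φ α → Extends φ α'
extends-resp φ α≗α' (β , s) = β , sat-resp [ α≗α' , (λ _ → refl) ] φ s

model⇒extends : ∀ {n ℓ} (φ : CNF (Var n ℓ)) {ρ α} → ρ ∘ inj₁ ≗ α → Sat ρ φ → Extends φ α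
model⇒extends φ {ρ} ρ≗α s = ρ ∘ inj₂ , sat-resp [ ρ≗α , (λ _ → refl) ] φ s

extends? : ∀ {n ℓ} (φ : CNF (Var n ℓ)) α → Dec (Extends φ α)
extends? φ α = map′ (λ { (s , p) → lookup s , p })
                    (λ { (β , p) → tabulate β , sat-resp [ (λ _ → refl) , sym ∘ lookup∘tabulate β ] φ p })
                    (anySubset? λ s → sat? [ α , lookup s ] φ)

module PEncoding {n ℓ} (φ : CNF (Var n ℓ)) (pe : IsPEncoding φ) where

  -- (P2) and soundness: the input part of every model has at most one 1.
  model-atMostOne : ∀ {ρ} → Sat ρ φ → AtMostOne (ρ ∘ inj₁)
  model-atMostOne s i j i≢j xi-true =
    not-injective (⊢₁-sound s xi-true (proj₂ pe i j i≢j))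

  extends⇒count≤1 : ∀ α → Extends φ α → countTrue α ≡ 0 ⊎ countTrue α ≡ 1
  extends⇒count≤1 α (β , s) = atMostOne⇒count≤1 α (model-atMostOne s)

  -- (P1): the model with xᵢ = 1 has the i-th unit vector as input part.
  count≡1⇒extends : ∀ α → countTrue α ≡ 1 → Extends φ α
  count≡1⇒extends α e with count≡1⇒unit α e
  ... | i , αi , others with proj₁ pe i
  ... | ρ , (here xi-true ∷ s) = model⇒extends φ agree s
    where
    agree : ρ ∘ inj₁ ≗ α
    agree j with j ≟ i
    ... | yes refl = trans xi-true (sym αi)
    ... | no j≢i   = trans (model-atMostOne s i j (j≢i ∘ sym) xi-true) (sym (others j j≢i))

  count≡0⇒extends⇔ : ∀ α → countTrue α ≡ 0 → Extends φ α ⇔ Extends φ allFalse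
  count≡0⇒extends⇔ α e = mk⇔ (extends-resp φ α≗0) (extends-resp φ (sym ∘ α≗0))
    where
    α≗0 : α ≗ allFalse
    α≗0 = Equivalence.to (count≡0⇔allFalse α) e

  encodes-AMO : Extends φ allFalse → IsEncoding φ AMO
  encodes-AMO zero-extends α = mk⇔
    (to ∘ Equivalence.to (≤ᵇ1⇔ (countTrue α)))
    (Equivalence.from (≤ᵇ1⇔ (countTrue α)) ∘ extends⇒count≤1 α)
    where
    to : countTrue α ≡ 0 ⊎ countTrue α ≡ 1 → Extends φ α
    to (inj₁ e) = Equivalence.from (count≡0⇒extends⇔ α e) zero-extends
    to (inj₂ e) = count≡1⇒extends α e

  encodes-EO : ¬ Extends φ allFalse → IsEncoding φ EO
  encodes-EO zero-fails α = mk⇔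
    (count≡1⇒extends α ∘ Equivalence.to (≡ᵇ1⇔ (countTrue α)))
    (Equivalence.from (≡ᵇ1⇔ (countTrue α)) ∘ extends⇒count≡1)
    where
    extends⇒count≡1 : Extends φ α → countTrue α ≡ 1
    extends⇒count≡1 ext with extends⇒count≤1 α ext
    ... | inj₁ e = ⊥-elim (zero-fails (Equivalence.to (count≡0⇒extends⇔ α e) ext))
    ... | inj₂ e = e

lemma4 : (n ℓ : ℕ) (φ : CNF (Var n ℓ)) → WellFormed φ → IsPEncoding φ →
    IsEncoding φ AMO ⊎ IsEncoding φ EO
lemma4 n ℓ φ _ pe with extends? φ allFalse
... | yes zero-extends = inj₁ (PEncoding.encodes-AMO φ pe zero-extends)
... | no zero-fails    = inj₂ (PEncoding.encodes-EO φ pe zero-fails)
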